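{- Let $v,k$ be positive integers with $k\equiv 0\pmod 2$. Then there exists an AOA$(1,k-1,k,v)$.
   Context: An orthogonal array OA$(t,k,v)$ is a $v^t\times k$ array with entries from a set $X$ of size $v$ such that the restriction to any $t$ columns contains every $t$-tuple of $X^t$ exactly once. An AOA$(s,t,k,v)$ is a $v^t\times (k+1)$ array $A$ such that: (1) the first $k$ columns form an OA$(t,k,v)$ on a set $X$ with $|X|=v$; (2) the last column has symbols from a set $Y$ with $|Y|=v^{t-s}$; (3) any $s$ of the first $k$ columns together with the last column contain every $(s+1)$-tuple of $X^s\times Y$ exactly once. -}

module Defs where

open import Data.Nat using (ℕ; _^_; _∸_)
open import Data.Fin using (Fin)
open import Data.Vec using (Vec; tabulate)
open import Data.Product using (Σ; _×_; ∃!)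
open import Relation.Binary.PropositionalEquality using (_≡_)
open import Function.Definitions using (Injective)

Array : ℕ → ℕ → ℕ → Set
Array r k v = Fin r → Fin k → Fin v

Columns : ℕ → ℕ → Set
Columns t k = Σ (Fin t → Fin k) (λ c → Injective _≡_ _≡_ c)

rowTuple : ∀ {r k v t} → Array r k v → (Fin t → Fin k) → Fin r → Vec (Fin v) t
rowTuple A c i = tabulate (λ j → A i (c j))

IsOA : (t k v : ℕ) → Array (v ^ t) k v → Set
IsOA t k v A =
  (C : Columns t k) → (x : Vec (Fin v) t) →
  ∃! _≡_ (λ i → rowTuple A (Data.Product.proj₁ C) i ≡ x)

-- AOA(s,t,k,v): a v^t × (k+1) array, given as the first k columns A (over
-- X = Fin v) and the last column L (over Y = Fin (v^(t-s))).
record AOA (s t k v : ℕ) : Set where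
  field
    A    : Array (v ^ t) k v
    L    : Fin (v ^ t) → Fin (v ^ (t ∸ s))
    isOA : IsOA t k v A
    aug  : (C : Columns s k) → (x : Vec (Fin v) s) → (y : Fin (v ^ (t ∸ s))) →
           ∃! _≡_ (λ i → (rowTuple A (Data.Product.proj₁ C) i ≡ x) × (L i ≡ y))

{-# OPTIONS --safe #-}
-- Fix an abelian group structure G on the v symbols (ℤ/v will do) and let n = k − 1, which is odd.
-- The rows are all words x ∈ Gⁿ; the first k columns are x preceded by the check symbol −Σx, and
-- the last column is the vector of adjacent sums (x₀ + x₁, …, x₍ₙ₋₂₎ + x₍ₙ₋₁₎) ∈ Gⁿ⁻¹.  Any n
-- coordinates of a zero-sum word determine the missing one, which gives the OA.  The adjacent sums
-- determine x as soon as one letter is known, and because n is odd they also determine Σx − x₀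
-- (the sum of the odd-indexed adjacent sums), so the check symbol recovers x₀.  Comparing the
-- number of rows with the number of targets turns each injectivity statement into unique existence.
module Submission where

open import Defs
open import Data.Nat using (ℕ; _∸_; _%_; _>_; _^_)
open import Relation.Binary.PropositionalEquality using (_≡_)

open import Algebra.Bundles using (AbelianGroup)
open import Algebra.Core using (Op₁; Op₂)
open import Algebra.Structures using (IsAbelianGroup)
open import Data.Fin using (Fin; zero; suc; toℕ; fromℕ<; inject₁; punchOut; combine; funToFin; finToFun)
open import Data.Fin.Properties using (toℕ-injective; toℕ-fromℕ<; toℕ<n; fromℕ<-cong; any?; _≟_;
  injective⇒≤; punchOut-injective; punchInᵢ≢i; combine-injective; funToFin-finToFin; finToFun-funToFin)
open import Data.Nat as ℕ using (NonZero; _*_; >-nonZero⁻¹)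
open import Data.Nat.DivMod using (m%n<n; m<n⇒m%n≡m; m%n%n≡m%n; %-distribˡ-+; n%n≡0)
open import Data.Nat.Divisibility using (divides; m%n≡0⇒n∣m)
open import Data.Nat.Properties as ℕₚ using (1+n≰n)
open import Data.Product using (_×_; _,_; proj₁; ∃; ∃!; map₂)
open import Data.Product.Properties using (,-injectiveˡ; ,-injectiveʳ)
open import Data.Vec using (Vec; []; _∷_; lookup; tabulate; head)
open import Data.Vec.Properties using (lookup∘tabulate; tabulate∘lookup; tabulate-cong)
open import Data.Vec.Functional as Vector using (Vector; removeAt)
open import Function using (_∘_)
open import Function.Bundles using (Injection; _↣_; mk↣)
open import Function.Definitions using (Injective; StrictlySurjective)
open import Relation.Binary.PropositionalEquality
  using (_≢_; _≗_; refl; sym; trans; cong; cong₂; subst; isEquivalence; module ≡-Reasoning)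
open import Relation.Nullary using (yes; no; contradiction)

injective⇒surjective : ∀ {n} {f : Fin n → Fin n} → Injective _≡_ _≡_ f → StrictlySurjective _≡_ f
injective⇒surjective {ℕ.suc n} {f} f-inj y with any? (λ i → f i ≟ y)
... | yes hit = hit
... | no miss = contradiction (injective⇒≤ f′-inj) 1+n≰n
  where
    f′ : Fin (ℕ.suc n) → Fin n
    f′ i = punchOut {i = y} {j = f i} (λ y≡fi → miss (i , sym y≡fi))
    f′-inj : Injective _≡_ _≡_ f′
    f′-inj eq = f-inj (punchOut-injective {i = y} _ _ eq)

injective∧misses⇒hits : ∀ {n} {c : Fin n → Fin (ℕ.suc n)} → Injective _≡_ _≡_ c →
                        ∀ {a b} → (∀ j → c j ≢ a) → b ≢ a → ∃ λ j → c j ≡ b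
injective∧misses⇒hits {n} {c} c-inj {a} {b} misses b≢a =
  map₂ (punchOut-injective {i = a} _ _) (injective⇒surjective c′-inj (punchOut (b≢a ∘ sym)))
  where
    c′ : Fin n → Fin n
    c′ j = punchOut {i = a} (misses j ∘ sym)
    c′-inj : Injective _≡_ _≡_ c′
    c′-inj eq = c-inj (punchOut-injective {i = a} _ _ eq)

injective⇒∃!preimage : ∀ {n b} {B : Set b} {g : Fin n → B} → Injective _≡_ _≡_ g →
                       B ↣ Fin n → ∀ y → ∃! _≡_ (λ i → g i ≡ y)
injective⇒∃!preimage g-inj e y
  with i , eq ← injective⇒surjective (g-inj ∘ Injection.injective e) (Injection.to e y)
  = i , e-inj eq , λ gj≡y → g-inj (trans (e-inj eq) (sym gj≡y))
  where
    e-inj : Injective _≡_ _≡_ (Injection.to e)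
    e-inj = Injection.injective e

rowTuple≡⇒≗ : ∀ {r k v t} (A : Array r k v) (c : Fin t → Fin k) {i j} →
              rowTuple A c i ≡ rowTuple A c j → A i ∘ c ≗ A j ∘ c
rowTuple≡⇒≗ A c {i} {j} eq l = begin
  A i (c l)                           ≡⟨ lookup∘tabulate (A i ∘ c) l ⟨
  lookup (rowTuple A c i) l           ≡⟨ cong (λ xs → lookup xs l) eq ⟩
  lookup (rowTuple A c j) l           ≡⟨ lookup∘tabulate (A j ∘ c) l ⟩
  A j (c l)                           ∎
  where open ≡-Reasoning

funToFin-cong : ∀ {m n} {f g : Fin m → Fin n} → f ≗ g → funToFin f ≡ funToFin g
funToFin-cong {ℕ.zero}  f≗g = refl
funToFin-cong {ℕ.suc m} f≗g = cong₂ combine (f≗g zero) (funToFin-cong (f≗g ∘ suc))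

funToFin-injective : ∀ {m n} {f g : Fin m → Fin n} → funToFin f ≡ funToFin g → f ≗ g
funToFin-injective {f = f} {g} eq i =
  trans (sym (finToFun-funToFin f i)) (trans (cong (λ r → finToFun r i) eq) (finToFun-funToFin g i))

finToFun-injective : ∀ {m n} {r s : Fin (m ^ n)} → finToFun {m} {n} r ≗ finToFun s → r ≡ s
finToFun-injective {m} {n} {r} {s} eq =
  trans (sym (funToFin-finToFin {n} {m} r)) (trans (funToFin-cong eq) (funToFin-finToFin {n} {m} s))

Vec↣Fin^ : ∀ {m n} → Vec (Fin m) n ↣ Fin (m ^ n)
Vec↣Fin^ {m} {n} = mk↣ {to = to} to-injective
  where
  to : Vec (Fin m) n → Fin (m ^ n)
  to = funToFin ∘ lookup
  to-injective : Injective _≡_ _≡_ to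
  to-injective {xs} {ys} eq = begin
    xs                   ≡⟨ tabulate∘lookup xs ⟨
    tabulate (lookup xs) ≡⟨ tabulate-cong (funToFin-injective eq) ⟩
    tabulate (lookup ys) ≡⟨ tabulate∘lookup ys ⟩
    ys                   ∎
    where open ≡-Reasoning

Vec1×Fin^↣Fin^ : ∀ {m n} → (Vec (Fin m) 1 × Fin (m ^ n)) ↣ Fin (m ^ ℕ.suc n)
Vec1×Fin^↣Fin^ {m} {n} = mk↣ {to = to} to-injective
  where
  to : Vec (Fin m) 1 × Fin (m ^ n) → Fin (m ^ ℕ.suc n)
  to (xs , y) = combine (head xs) y
  to-injective : Injective _≡_ _≡_ to
  to-injective {a ∷ [] , y} {b ∷ [] , z} eq with refl , refl ← combine-injective a y b z eq = refl

module Modular (n : ℕ) .{{_ : NonZero n}} where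

  reduce : ℕ → Fin n
  reduce k = fromℕ< (m%n<n k n)

  toℕ-reduce : ∀ k → toℕ (reduce k) ≡ k % n
  toℕ-reduce k = toℕ-fromℕ< (m%n<n k n)

  reduce-toℕ : ∀ a → reduce (toℕ a) ≡ a
  reduce-toℕ a = toℕ-injective (trans (toℕ-reduce (toℕ a)) (m<n⇒m%n≡m (toℕ<n a)))

  reduce-cong : ∀ {k l} → k % n ≡ l % n → reduce k ≡ reduce l
  reduce-cong eq = fromℕ<-cong _ _ eq _ _

  reduce-+ˡ : ∀ k l → reduce (toℕ (reduce k) ℕ.+ l) ≡ reduce (k ℕ.+ l)
  reduce-+ˡ k l = reduce-cong (begin
    (toℕ (reduce k) ℕ.+ l) % n   ≡⟨ cong (λ t → (t ℕ.+ l) % n) (toℕ-reduce k) ⟩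
    (k % n ℕ.+ l) % n            ≡⟨ %-distribˡ-+ (k % n) l n ⟩
    (k % n % n ℕ.+ l % n) % n    ≡⟨ cong (λ t → (t ℕ.+ l % n) % n) (m%n%n≡m%n k n) ⟩
    (k % n ℕ.+ l % n) % n        ≡⟨ %-distribˡ-+ k l n ⟨
    (k ℕ.+ l) % n                ∎)
    where open ≡-Reasoning

  infixl 6 _+_

  _+_ : Op₂ (Fin n)
  a + b = reduce (toℕ a ℕ.+ toℕ b)

  0# : Fin n
  0# = reduce 0

  -_ : Op₁ (Fin n)
  - a = reduce (n ∸ toℕ a)

  +-comm : ∀ a b → a + b ≡ b + a
  +-comm a b = cong reduce (ℕₚ.+-comm (toℕ a) (toℕ b))

  +-assoc : ∀ a b c → (a + b) + c ≡ a + (b + c)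
  +-assoc a b c = begin
    reduce (toℕ (reduce (x ℕ.+ y)) ℕ.+ z)  ≡⟨ reduce-+ˡ (x ℕ.+ y) z ⟩
    reduce (x ℕ.+ y ℕ.+ z)                 ≡⟨ cong reduce (ℕₚ.+-assoc x y z) ⟩
    reduce (x ℕ.+ (y ℕ.+ z))               ≡⟨ cong reduce (ℕₚ.+-comm x (y ℕ.+ z)) ⟩
    reduce (y ℕ.+ z ℕ.+ x)                 ≡⟨ reduce-+ˡ (y ℕ.+ z) x ⟨
    (b + c) + a                            ≡⟨ +-comm (b + c) a ⟩
    a + (b + c)                            ∎
    where
      open ≡-Reasoning
      x y z : ℕ
      x = toℕ a
      y = toℕ b
      z = toℕ c

  +-identityˡ : ∀ a → 0# + a ≡ a
  +-identityˡ a = trans (reduce-+ˡ 0 (toℕ a)) (reduce-toℕ a)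

  +-inverseˡ : ∀ a → (- a) + a ≡ 0#
  +-inverseˡ a = begin
    reduce (toℕ (reduce (n ∸ toℕ a)) ℕ.+ toℕ a)  ≡⟨ reduce-+ˡ (n ∸ toℕ a) (toℕ a) ⟩
    reduce (n ∸ toℕ a ℕ.+ toℕ a)                 ≡⟨ cong reduce (ℕₚ.m∸n+n≡m (ℕₚ.<⇒≤ (toℕ<n a))) ⟩
    reduce n                                     ≡⟨ reduce-cong (trans (n%n≡0 n) (sym (m<n⇒m%n≡m (>-nonZero⁻¹ n)))) ⟩
    0#                                           ∎
    where open ≡-Reasoning

  +-isAbelianGroup : IsAbelianGroup _≡_ _+_ 0# -_
  +-isAbelianGroup = record
    { isGroup = record
      { isMonoid = record
        { isSemigroup = record
          { isMagma = record { isEquivalence = isEquivalence ; ∙-cong = cong₂ _+_ }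
          ; assoc = +-assoc
          }
        ; identity = +-identityˡ , λ a → trans (+-comm a 0#) (+-identityˡ a)
        }
      ; inverse = +-inverseˡ , λ a → trans (+-comm a (- a)) (+-inverseˡ a)
      ; ⁻¹-cong = cong -_
      }
    ; comm = +-comm
    }

module Words {a} {A : Set a} {_∙_ : Op₂ A} {ε : A} {_⁻¹ : Op₁ A}
             (isAbelianGroup : IsAbelianGroup _≡_ _∙_ ε _⁻¹) where

  abelianGroup : AbelianGroup a a
  abelianGroup = record { isAbelianGroup = isAbelianGroup }

  open AbelianGroup abelianGroup using (assoc; inverseˡ; commutativeMonoid)
  open import Algebra.Properties.AbelianGroup abelianGroup using (∙-cancelˡ; ∙-cancelʳ; ⁻¹-injective)
  open import Algebra.Properties.CommutativeMonoid.Sum commutativeMonoid using (sum; sum-remove; sum-cong-≗)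
  open ≡-Reasoning

  sum≡∧removeAt≗⇒≡ : ∀ {n} (u w : Vector A (ℕ.suc n)) p →
                     sum u ≡ sum w → removeAt u p ≗ removeAt w p → u p ≡ w p
  sum≡∧removeAt≗⇒≡ u w p Σu≡Σw rest≗ = ∙-cancelʳ (sum (removeAt u p)) (u p) (w p) (begin
    u p ∙ sum (removeAt u p)  ≡⟨ sum-remove {i = p} u ⟨
    sum u                     ≡⟨ Σu≡Σw ⟩
    sum w                     ≡⟨ sum-remove {i = p} w ⟩
    w p ∙ sum (removeAt w p)  ≡⟨ cong (w p ∙_) (sum-cong-≗ rest≗) ⟨
    w p ∙ sum (removeAt u p)  ∎)

  sum≡∧agreeOnInjective⇒≗ : ∀ {n} {c : Fin n → Fin (ℕ.suc n)} → Injective _≡_ _≡_ c →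
                            (u w : Vector A (ℕ.suc n)) → sum u ≡ sum w → u ∘ c ≗ w ∘ c → u ≗ w
  sum≡∧agreeOnInjective⇒≗ {c = c} c-inj u w Σu≡Σw agree q with any? (λ j → c j ≟ q)
  ... | yes (j , cj≡q) = subst (λ i → u i ≡ w i) cj≡q (agree j)
  ... | no missed = sum≡∧removeAt≗⇒≡ u w q Σu≡Σw agreeOffq
    where
      agreeOffq : removeAt u q ≗ removeAt w q
      agreeOffq j with j′ , cj′≡ ← injective∧misses⇒hits c-inj (λ i eq → missed (i , eq)) (punchInᵢ≢i q j)
        = subst (λ i → u i ≡ w i) cj′≡ (agree j′)

  extend : ∀ {n} → Vector A n → Vector A (ℕ.suc n)
  extend x = (sum x ⁻¹) Vector.∷ x

  sum-extend : ∀ {n} (x : Vector A n) → sum (extend x) ≡ ε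
  sum-extend x = inverseˡ (sum x)

  pairSums : ∀ {n} → Vector A (ℕ.suc n) → Vector A n
  pairSums x i = x (inject₁ i) ∙ x (suc i)

  oddIndex : ∀ {m} → Fin m → Fin (m * 2)
  oddIndex zero    = suc zero
  oddIndex (suc i) = suc (suc (oddIndex i))

  sum-oddLength : ∀ m (x : Vector A (ℕ.suc (m * 2))) →
                  sum x ≡ x zero ∙ sum (λ i → pairSums x (oddIndex {m} i))
  sum-oddLength ℕ.zero    x = refl
  sum-oddLength (ℕ.suc m) x = begin
    x₀ ∙ (x (suc zero) ∙ sum y)                 ≡⟨ cong (λ t → x₀ ∙ (x (suc zero) ∙ t)) (sum-oddLength m y) ⟩
    x₀ ∙ (x (suc zero) ∙ (y zero ∙ S))          ≡⟨ cong (x₀ ∙_) (assoc _ _ _) ⟨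
    x₀ ∙ ((x (suc zero) ∙ y zero) ∙ S)          ∎
    where
      x₀ : A
      x₀ = x zero
      y : Vector A (ℕ.suc (m * 2))
      y = x ∘ suc ∘ suc
      S : A
      S = sum (λ i → pairSums y (oddIndex {m} i))

  pairSums≗⇒agreement-spreads : ∀ {n} (x y : Vector A (ℕ.suc n)) → pairSums x ≗ pairSums y →
                                ∀ j → x j ≡ y j → x ≗ y
  pairSums≗⇒agreement-spreads {ℕ.zero}  x y ps zero    eq zero    = eq
  pairSums≗⇒agreement-spreads {ℕ.suc n} x y ps zero    eq zero    = eq
  pairSums≗⇒agreement-spreads {ℕ.suc n} x y ps zero    eq (suc i) =
    pairSums≗⇒agreement-spreads (x ∘ suc) (y ∘ suc) (ps ∘ suc) zero
      (∙-cancelˡ (x zero) _ _ (trans (ps zero) (cong (_∙ y (suc zero)) (sym eq)))) i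
  pairSums≗⇒agreement-spreads {ℕ.suc n} x y ps (suc j) eq = λ where
      zero    → ∙-cancelʳ (x (suc zero)) _ _ (trans (ps zero) (cong (y zero ∙_) (sym (tail≗ zero))))
      (suc i) → tail≗ i
    where
      tail≗ : x ∘ suc ≗ y ∘ suc
      tail≗ = pairSums≗⇒agreement-spreads (x ∘ suc) (y ∘ suc) (ps ∘ suc) j eq

  extend∧pairSums-determine : ∀ m (x y : Vector A (ℕ.suc (m * 2))) p →
                              extend x p ≡ extend y p → pairSums x ≗ pairSums y → x ≗ y
  extend∧pairSums-determine m x y (suc j) xj≡yj ps = pairSums≗⇒agreement-spreads x y ps j xj≡yj
  extend∧pairSums-determine m x y zero    Σ⁻¹≡ ps = pairSums≗⇒agreement-spreads x y ps zero x₀≡y₀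
    where
      Sx Sy : A
      Sx = sum (λ i → pairSums x (oddIndex {m} i))
      Sy = sum (λ i → pairSums y (oddIndex {m} i))
      x₀≡y₀ : x zero ≡ y zero
      x₀≡y₀ = ∙-cancelʳ Sx (x zero) (y zero) (begin
        x zero ∙ Sx  ≡⟨ sum-oddLength m x ⟨
        sum x        ≡⟨ ⁻¹-injective Σ⁻¹≡ ⟩
        sum y        ≡⟨ sum-oddLength m y ⟩
        y zero ∙ Sy  ≡⟨ cong (y zero ∙_) (sum-cong-≗ {m} (ps ∘ oddIndex)) ⟨
        y zero ∙ Sx  ∎)

module ZeroSumCode {v} {_∙_ : Op₂ (Fin v)} {ε : Fin v} {_⁻¹ : Op₁ (Fin v)}
                   (isAbelianGroup : IsAbelianGroup _≡_ _∙_ ε _⁻¹) where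

  open Words isAbelianGroup

  zeroSumArray : ∀ n → Array (v ^ n) (ℕ.suc n) v
  zeroSumArray n r = extend (finToFun {v} {n} r)

  zeroSumArray-isOA : ∀ n → IsOA n (ℕ.suc n) v (zeroSumArray n)
  zeroSumArray-isOA n (c , c-inj) = injective⇒∃!preimage rows-inj Vec↣Fin^
    where
      rows-inj : Injective _≡_ _≡_ (rowTuple (zeroSumArray n) c)
      rows-inj {r} {s} eq = finToFun-injective λ i →
        sum≡∧agreeOnInjective⇒≗ c-inj (zeroSumArray n r) (zeroSumArray n s)
          (trans (sum-extend (finToFun {v} {n} r)) (sym (sum-extend (finToFun {v} {n} s))))
          (rowTuple≡⇒≗ (zeroSumArray n) c eq) (suc i)

  pairSumColumn : ∀ m → Fin (v ^ ℕ.suc (m * 2)) → Fin (v ^ (m * 2))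
  pairSumColumn m r = funToFin (pairSums (finToFun {v} {ℕ.suc (m * 2)} r))

  zeroSumArray-aug : ∀ m (C : Columns 1 (ℕ.suc (ℕ.suc (m * 2)))) x y →
                  ∃! _≡_ (λ r → rowTuple (zeroSumArray (ℕ.suc (m * 2))) (proj₁ C) r ≡ x × pairSumColumn m r ≡ y)
  zeroSumArray-aug m (c , _) x y = split (injective⇒∃!preimage rows-inj (Vec1×Fin^↣Fin^ {v} {m * 2}) (x , y))
    where
      row : Fin (v ^ ℕ.suc (m * 2)) → Vec (Fin v) 1 × Fin (v ^ (m * 2))
      row r = rowTuple (zeroSumArray (ℕ.suc (m * 2))) c r , pairSumColumn m r
      rows-inj : Injective _≡_ _≡_ row
      rows-inj {r} {s} eq = finToFun-injective
        (extend∧pairSums-determine m (finToFun r) (finToFun s) (c zero)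
          (rowTuple≡⇒≗ (zeroSumArray (ℕ.suc (m * 2))) c (,-injectiveˡ eq) zero)
          (funToFin-injective (,-injectiveʳ eq)))
      split : ∃! _≡_ (λ r → row r ≡ (x , y)) →
              ∃! _≡_ (λ r → rowTuple (zeroSumArray (ℕ.suc (m * 2))) c r ≡ x × pairSumColumn m r ≡ y)
      split (r , eq , unique) =
        r , (,-injectiveˡ eq , ,-injectiveʳ eq) , λ (ex , ey) → unique (cong₂ _,_ ex ey)

  zeroSumAOA : ∀ m → AOA 1 (ℕ.suc (m * 2)) (ℕ.suc (ℕ.suc (m * 2))) v
  zeroSumAOA m = record
    { A    = zeroSumArray (ℕ.suc (m * 2))
    ; L    = pairSumColumn m
    ; isOA = zeroSumArray-isOA (ℕ.suc (m * 2))
    ; aug  = zeroSumArray-aug m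
    }

theorem2p4 : (v k : ℕ) → v > 0 → k > 0 → k % 2 ≡ 0 → AOA 1 (k ∸ 1) k v
theorem2p4 (ℕ.suc v) k _ k>0 k-even with m%n≡0⇒n∣m k 2 k-even
theorem2p4 (ℕ.suc v) ._ _ () _ | divides ℕ.zero    refl
theorem2p4 (ℕ.suc v) ._ _ _  _ | divides (ℕ.suc m) refl =
  ZeroSumCode.zeroSumAOA (Modular.+-isAbelianGroup (ℕ.suc v)) m
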